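{- Let $G=(V,E)$ be an undirected graph with vertex set $V=\{1,\dots,n\}$ (vertices numbered along the protein main chain) and nonnegative edge weights $w$, let $k\ge 2$ be an integer, let $\epsilon\ge 0$, let $\mathrm{maxSize}=(1+\epsilon)\lceil n/k\rceil$, and let a subset $C\subseteq V$ of charged vertices be given. Let the table $\mathrm{partCut}[i][j]$, $1\le i\le n$, $1\le j\le k$, be filled by the dynamic program described in the context. Then, after the dynamic program has been executed, for every $i\in\{1,\dots,n\}$ and $j\in\{1,\dots,k\}$, $\mathrm{partCut}[i][j]$ equals the minimum cut weight of a feasible continuous $j$-partition of $\{1,\dots,i\}$; if no such partition exists, $\mathrm{partCut}[i][j]=\infty$.
   Context: For $1\le i\le n$, a continuous $j$-partition of $\{1,\dots,i\}$ is a partition of $\{1,\dots,i\}$ into $j$ nonempty fragments each consisting of consecutive integers, i.e. fragments $\{1,\dots,d_1\},\{d_1+1,\dots,d_2\},\dots,\{d_{j-1}+1,\dots,i\}$ with $1\le d_1<d_2<\dots<d_{j-1}<i$. It is feasible if every fragment has at most $\mathrm{maxSize}$ vertices and contains at most one vertex of $C$. Its cut weight is the sum of $w(u,v)$ over all edges $\{u,v\}\in E$ with $u,v\in\{1,\dots,i\}$ and $u,v$ in different fragments. For $0\le l<i\le n$ define $c[l][i]=\sum w(u,v)$ over edges $\{u,v\}\in E$ with $u\in\{1,\dots,l\}$ and $v\in\{l+1,\dots,i\}$. The dynamic program: initially all entries of $\mathrm{partCut}$ are $\infty$; for $j=1$, set $\mathrm{partCut}[i][1]=0$ for those $i$ with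 $i\le\mathrm{maxSize}$ and $|\{1,\dots,i\}\cap C|\le 1$. Then for $i=1,\dots,n$ and $j=2,\dots,k$, set $\mathrm{partCut}[i][j]=\min_{l} \big(\mathrm{partCut}[l][j-1]+c[l][i]\big)$, where $l$ ranges over the valid predecessors of $i$: integers $l$ with $\max(i-\mathrm{maxSize},1)\le l\le i-1$ such that $\{l+1,\dots,i\}$ contains at most one vertex of $C$ (the minimum over an empty set being $\infty$); the minimizing $l$ is stored as $\mathrm{pred}[i][j]$.
   Formalization: The edge weights w and the parameter ε take rational values. -}

module Defs where

open import Data.Bool using (Bool; true; false; if_then_else_; _∧_)
open import Data.Nat as ℕ using (ℕ; zero; suc; _∸_; _≤ᵇ_; _<ᵇ_)
open import Data.Nat.DivMod using (_/_)
open import Data.Integer using (+_)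
open import Data.Rational as ℚ using (ℚ; 0ℚ; 1ℚ; _+_; _-_; _*_; _≤_)
import Data.Rational.Properties as ℚP
open import Data.Fin using (Fin; fromℕ; inject₁) renaming (suc to fsuc; zero to fzero)
open import Data.List using (List; []; _∷_; map; upTo; foldr; allFin)
open import Data.Bool.ListAction using (any)
open import Data.Maybe using (Maybe; just; nothing)
open import Data.Product using (Σ; _×_; _,_)
open import Relation.Nullary using (¬_; does)
open import Relation.Binary.PropositionalEquality using (_≡_)

toℚ : ℕ → ℚ
toℚ m = + m ℚ./ 1

-- ⌈ n / k ⌉  (k ≥ 1 in all uses)
ceilDiv : ℕ → ℕ → ℕ
ceilDiv n zero    = 0
ceilDiv n (suc k) = (n ℕ.+ k) / suc k

maxSize : ℕ → ℕ → ℚ → ℚ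
maxSize n k ε = (1ℚ + ε) * toℚ (ceilDiv n k)

-- the list [a+1, …, b]  (empty if b ≤ a)
between : ℕ → ℕ → List ℕ
between a b = map (λ x → a ℕ.+ suc x) (upTo (b ∸ a))

sumℚ : List ℚ → ℚ
sumℚ = foldr _+_ 0ℚ

charged : (ℕ → Bool) → ℕ → ℕ → ℕ
charged C a b = foldr (λ v acc → if C v then suc acc else acc) 0 (between a b)

cTab : (ℕ → ℕ → Bool) → (ℕ → ℕ → ℚ) → ℕ → ℕ → ℚ
cTab E w l i =
  sumℚ (map (λ u → sumℚ (map (λ v → if E u v then w u v else 0ℚ) (between l i)))
            (between 0 l))

-- extended values: nothing = ∞
Ext : Set
Ext = Maybe ℚ

minExt : Ext → Ext → Ext
minExt nothing y = y
minExt x nothing = x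
minExt (just a) (just b) = if a ℚ.≤ᵇ b then just a else just b

addExt : Ext → ℚ → Ext
addExt nothing  c = nothing
addExt (just a) c = just (a + c)

validPred : (ms : ℚ) (C : ℕ → Bool) (l i : ℕ) → Bool
validPred ms C l i =
  (1 ≤ᵇ l) ∧ (l <ᵇ i) ∧ does ((toℚ i - ms) ℚP.≤? toℚ l) ∧ (charged C l i ≤ᵇ 1)

-- The loops in the
-- paper (i outer, j inner) only ever read entries partCut[l][j-1] with l < i,
-- so the table is the following recursive function on j.
partCut : (n k : ℕ) (ε : ℚ) (E : ℕ → ℕ → Bool) (w : ℕ → ℕ → ℚ) (C : ℕ → Bool)
          → ℕ → ℕ → Ext
partCut n k ε E w C i zero = nothing
partCut n k ε E w C i (suc zero) =
  if (1 ≤ᵇ i) ∧ does (toℚ i ℚP.≤? maxSize n k ε) ∧ (charged C 0 i ≤ᵇ 1)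
  then just 0ℚ else nothing
partCut n k ε E w C i (suc (suc j)) =
  foldr (λ l acc → if validPred (maxSize n k ε) C l i
                   then minExt (addExt (partCut n k ε E w C l (suc j)) (cTab E w l i)) acc
                   else acc)
        nothing (between 0 i)

-- A continuous j-partition of {1..i}: boundaries d₀ = 0 < d₁ < … < d_j = i;
-- fragment t (t : Fin j) is {d_t + 1, …, d_{t+1}}.
record ContPartition (i j : ℕ) : Set where
  field
    d       : Fin (suc j) → ℕ
    d-first : d fzero ≡ 0
    d-last  : d (fromℕ j) ≡ i
    d-incr  : (t : Fin j) → d (inject₁ t) ℕ.< d (fsuc t)
open ContPartition public

Feasible : (ms : ℚ) (C : ℕ → Bool) {i j : ℕ} → ContPartition i j → Set
Feasible ms C {i} {j} p = (t : Fin j) →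
  (toℚ (d p (fsuc t) ∸ d p (inject₁ t)) ≤ ms) ×
  (charged C (d p (inject₁ t)) (d p (fsuc t)) ℕ.≤ 1)

-- for u < v in {1..i}: u and v lie in different fragments iff some
-- boundary d_t satisfies u ≤ d_t < v
separated : {i j : ℕ} → ContPartition i j → ℕ → ℕ → Bool
separated {i} {j} p u v = any (λ t → (u ≤ᵇ d p t) ∧ (d p t <ᵇ v)) (allFin (suc j))

cutWeight : (E : ℕ → ℕ → Bool) (w : ℕ → ℕ → ℚ) {i j : ℕ} → ContPartition i j → ℚ
cutWeight E w {i} {j} p =
  sumℚ (map (λ u → sumℚ (map (λ v → if E u v ∧ separated p u v then w u v else 0ℚ)
                               (between u i)))
            (between 0 i))

IsMinCut : (ms : ℚ) (C : ℕ → Bool) (E : ℕ → ℕ → Bool) (w : ℕ → ℕ → ℚ)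
           (i j : ℕ) → Ext → Set
IsMinCut ms C E w i j (just x) =
  (Σ (ContPartition i j) λ p → Feasible ms C p × (cutWeight E w p ≡ x)) ×
  ((p : ContPartition i j) → Feasible ms C p → x ≤ cutWeight E w p)
IsMinCut ms C E w i j nothing =
  ¬ (Σ (ContPartition i j) λ p → Feasible ms C p)

-- Optimal substructure.  Dropping the last fragment {l+1, …, i} of a continuous
-- (j+1)-partition p of {1, …, i} leaves a continuous j-partition q of {1, …, l}, and every
-- such q extends by that fragment.  Under this correspondence p is feasible iff q and the
-- last fragment are, and the latter is exactly what validPred tests; the cut weight of p is
-- that of q plus c[l][i], since an edge inside {1, …, l} is cut by p iff it is cut by q, an
-- edge from {1, …, l} to {l+1, …, i} is always cut, and an edge inside the last fragment
-- never is.  Hence, by induction on j, the minimum over valid l of partCut[l][j] + c[l][i]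
-- is the optimum.  A one-fragment partition is the empty partition of the empty set
-- followed by {1, …, i}, so the row j = 1 is the same decomposition.  None of the
-- hypotheses on E, w, k, ε or the range of i is needed.

module Submission where

open import Defs
open import Data.Bool using (Bool; true; false; T; if_then_else_; _∧_)
open import Data.Bool.Properties using (T-≡; T-∧; ∧-identityʳ; ∧-zeroʳ)
open import Data.Empty using (⊥-elim)
open import Data.Fin using (Fin; fromℕ; inject₁; punchIn) renaming (zero to fzero; suc to fsuc)
open import Data.Fin.Relation.Unary.Top using (view; ‵fromℕ; ‵inj₁)
open import Data.List using (List; []; _∷_; _++_; map; foldr; applyUpTo; allFin)
open import Data.List.Properties using (map-++)
open import Data.List.Membership.Propositional using (_∈_; lose)
open import Data.List.Membership.Propositional.Properties using (∈-allFin)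
open import Data.List.Relation.Unary.Any using (here; there; satisfied)
open import Data.List.Relation.Unary.Any.Properties using (any⁺; any⁻)
open import Data.Maybe using (just; nothing)
open import Data.Nat as ℕ using (ℕ; zero; suc; _∸_; _≤_; _<_; _≤ᵇ_; _<ᵇ_; z≤n; s≤s)
import Data.Nat.Properties as ℕP
open import Data.Nat.Coprimality using (1-coprimeTo) renaming (sym to coprime-sym)
import Data.Integer as ℤ
import Data.Integer.Properties as ℤP
open import Data.Rational as ℚ using (ℚ; mkℚ; 0ℚ; _+_; _-_; -_; _⊓_) renaming (_≤_ to _≤ℚ_)
import Data.Rational.Properties as ℚP
open import Data.Rational.Solver using (module +-*-Solver)
open import Data.Product using (∃; _×_; _,_; proj₁; proj₂)
open import Data.Sum using (_⊎_; inj₁; inj₂)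
open import Data.Vec.Functional using (init; insertAt)
open import Data.Vec.Functional.Properties using (insertAt-lookup; insertAt-punchIn)
open import Algebra.Bundles using (CommutativeMonoid)
open import Algebra.Properties.CommutativeSemigroup
  (CommutativeMonoid.commutativeSemigroup ℚP.+-0-commutativeMonoid) using (interchange)
open import Function using (_∘_; _⇔_; mk⇔; Equivalence)
open import Relation.Nullary using (Dec; yes; no; does)
open import Relation.Binary.PropositionalEquality

open Equivalence using (to; from)

interval : ℕ → ℕ → List ℕ
interval a zero    = []
interval a (suc m) = suc a ∷ interval (suc a) m

map-applyUpTo≡interval : ∀ (g f : ℕ → ℕ) a m → (∀ x → g (f x) ≡ a ℕ.+ suc x) →
                          map g (applyUpTo f m) ≡ interval a m
map-applyUpTo≡interval g f a zero    g∘f≡ = refl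
map-applyUpTo≡interval g f a (suc m) g∘f≡ =
  cong₂ _∷_ (trans (g∘f≡ 0) (ℕP.+-comm a 1))
            (map-applyUpTo≡interval g (f ∘ suc) (suc a) m
              (λ x → trans (g∘f≡ (suc x)) (ℕP.+-suc a (suc x))))

between≡interval : ∀ a b → between a b ≡ interval a (b ∸ a)
between≡interval a b =
  map-applyUpTo≡interval (λ x → a ℕ.+ suc x) (λ x → x) a (b ∸ a) (λ _ → refl)

interval-++ : ∀ a m n → interval a (m ℕ.+ n) ≡ interval a m ++ interval (a ℕ.+ m) n
interval-++ a zero    n rewrite ℕP.+-identityʳ a = refl
interval-++ a (suc m) n rewrite ℕP.+-suc a m = cong (suc a ∷_) (interval-++ (suc a) m n)

∈-interval⁻ : ∀ {a m x} → x ∈ interval a m → a < x × x ≤ a ℕ.+ m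
∈-interval⁻ {a} {suc m} (here refl) =
  ℕP.≤-refl , subst (suc a ≤_) (sym (ℕP.+-suc a m)) (s≤s (ℕP.m≤m+n a m))
∈-interval⁻ {a} {suc m} {x} (there x∈) with a<x , x≤ ← ∈-interval⁻ x∈ =
  ℕP.<⇒≤ a<x , subst (x ≤_) (sym (ℕP.+-suc a m)) x≤

∈-interval⁺ : ∀ {a m x} → a < x → x ≤ a ℕ.+ m → x ∈ interval a m
∈-interval⁺ {a} {zero}  a<x x≤a rewrite ℕP.+-identityʳ a = ⊥-elim (ℕP.<⇒≱ a<x x≤a)
∈-interval⁺ {a} {suc m} {x} a<x x≤ with x ℕ.≟ suc a
... | yes refl = here refl
... | no x≢1+a =
  there (∈-interval⁺ (ℕP.≤∧≢⇒< a<x (x≢1+a ∘ sym)) (subst (x ≤_) (ℕP.+-suc a m) x≤))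

between-++ : ∀ {a l b} → a ≤ l → l ≤ b → between a b ≡ between a l ++ between l b
between-++ {a} {l} {b} a≤l l≤b = begin
  between a b
    ≡⟨ between≡interval a b ⟩
  interval a (b ∸ a)
    ≡⟨ cong (interval a) b∸a≡ ⟩
  interval a ((l ∸ a) ℕ.+ (b ∸ l))
    ≡⟨ interval-++ a (l ∸ a) (b ∸ l) ⟩
  interval a (l ∸ a) ++ interval (a ℕ.+ (l ∸ a)) (b ∸ l)
    ≡⟨ cong (λ c → interval a (l ∸ a) ++ interval c (b ∸ l)) (ℕP.m+[n∸m]≡n a≤l) ⟩
  interval a (l ∸ a) ++ interval l (b ∸ l)
    ≡⟨ sym (cong₂ _++_ (between≡interval a l) (between≡interval l b)) ⟩
  between a l ++ between l b
    ∎
  where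
  open ≡-Reasoning
  b∸a≡ : b ∸ a ≡ (l ∸ a) ℕ.+ (b ∸ l)
  b∸a≡ = begin
    b ∸ a                   ≡⟨ cong (_∸ a) (sym (ℕP.m∸n+n≡m l≤b)) ⟩
    (b ∸ l) ℕ.+ l ∸ a       ≡⟨ ℕP.+-∸-assoc (b ∸ l) a≤l ⟩
    (b ∸ l) ℕ.+ (l ∸ a)     ≡⟨ ℕP.+-comm (b ∸ l) (l ∸ a) ⟩
    (l ∸ a) ℕ.+ (b ∸ l)     ∎

∈-between⁻ : ∀ {a b x} → x ∈ between a b → a < x × x ≤ b
∈-between⁻ {a} {b} x∈ rewrite between≡interval a b with a ℕP.≤? b
... | yes a≤b = subst (λ c → _ × _ ≤ c) (ℕP.m+[n∸m]≡n a≤b) (∈-interval⁻ x∈)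
... | no a≰b rewrite ℕP.m≤n⇒m∸n≡0 (ℕP.<⇒≤ (ℕP.≰⇒> a≰b)) with () ← x∈

∈-between⁺ : ∀ {a b x} → a < x → x ≤ b → x ∈ between a b
∈-between⁺ {a} {b} a<x x≤b rewrite between≡interval a b =
  ∈-interval⁺ a<x (subst (_ ≤_) (sym (ℕP.m+[n∸m]≡n (ℕP.<⇒≤ (ℕP.<-≤-trans a<x x≤b)))) x≤b)

sumℚ-++ : ∀ xs ys → sumℚ (xs ++ ys) ≡ sumℚ xs + sumℚ ys
sumℚ-++ []       ys = sym (ℚP.+-identityˡ (sumℚ ys))
sumℚ-++ (x ∷ xs) ys =
  trans (cong (x +_) (sumℚ-++ xs ys)) (sym (ℚP.+-assoc x (sumℚ xs) (sumℚ ys)))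

sumℚ-map-+ : ∀ (f g : ℕ → ℚ) xs →
             sumℚ (map (λ x → f x + g x) xs) ≡ sumℚ (map f xs) + sumℚ (map g xs)
sumℚ-map-+ f g []       = refl
sumℚ-map-+ f g (x ∷ xs) =
  trans (cong (f x + g x +_) (sumℚ-map-+ f g xs)) (interchange (f x) (g x) _ _)

sumℚ-map-cong : ∀ {f g : ℕ → ℚ} xs → (∀ {x} → x ∈ xs → f x ≡ g x) →
                sumℚ (map f xs) ≡ sumℚ (map g xs)
sumℚ-map-cong []       f≡g = refl
sumℚ-map-cong (x ∷ xs) f≡g = cong₂ _+_ (f≡g (here refl)) (sumℚ-map-cong xs (f≡g ∘ there))

sumℚ-map-vanishing : ∀ {f : ℕ → ℚ} xs → (∀ {x} → x ∈ xs → f x ≡ 0ℚ) →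
                     sumℚ (map f xs) ≡ 0ℚ
sumℚ-map-vanishing []       f≡0 = refl
sumℚ-map-vanishing (x ∷ xs) f≡0 =
  trans (cong₂ _+_ (f≡0 (here refl)) (sumℚ-map-vanishing xs (f≡0 ∘ there))) (ℚP.+-identityˡ 0ℚ)

sumℚ-between-++ : ∀ (f : ℕ → ℚ) {a l b} → a ≤ l → l ≤ b →
  sumℚ (map f (between a b)) ≡ sumℚ (map f (between a l)) + sumℚ (map f (between l b))
sumℚ-between-++ f {a} {l} {b} a≤l l≤b = begin
  sumℚ (map f (between a b))
    ≡⟨ cong (sumℚ ∘ map f) (between-++ a≤l l≤b) ⟩
  sumℚ (map f (between a l ++ between l b))
    ≡⟨ cong sumℚ (map-++ f (between a l) (between l b)) ⟩
  sumℚ (map f (between a l) ++ map f (between l b))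
    ≡⟨ sumℚ-++ (map f (between a l)) _ ⟩
  sumℚ (map f (between a l)) + sumℚ (map f (between l b))
    ∎
  where open ≡-Reasoning

toℚ≡mkℚ : ∀ m → toℚ m ≡ mkℚ (ℤ.+ m) 0 (coprime-sym (1-coprimeTo m))
toℚ≡mkℚ m = ℚP.normalize-coprime (coprime-sym (1-coprimeTo m))

toℚ-+ : ∀ a b → toℚ (a ℕ.+ b) ≡ toℚ a + toℚ b
toℚ-+ a b rewrite toℚ≡mkℚ a | toℚ≡mkℚ b =
  ℚP./-cong {p₁ = ℤ.+ (a ℕ.+ b)}
    (sym (cong₂ ℤ._+_ (ℤP.*-identityʳ (ℤ.+ a)) (ℤP.*-identityʳ (ℤ.+ b)))) refl

x+y-z≤y⇔x≤z : ∀ x y z → (x + y) - z ≤ℚ y ⇔ x ≤ℚ z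
x+y-z≤y⇔x≤z x y z = mk⇔
  (λ h → subst₂ _≤ℚ_ (solve 3 (λ x y z → ((x :+ y) :- z) :+ (z :- y) := x) refl x y z)
                      (solve 2 (λ y z → y :+ (z :- y) := z) refl y z)
                      (ℚP.+-monoˡ-≤ (z - y) h))
  (λ h → subst ((x + y) - z ≤ℚ_) (solve 2 (λ y z → (z :+ y) :- z := y) refl y z)
                (ℚP.+-monoˡ-≤ (- z) (ℚP.+-monoˡ-≤ y h)))
  where open +-*-Solver

T-does : ∀ {P : Set} (P? : Dec P) → T (does P?) ⇔ P
T-does (yes p)  = mk⇔ (λ _ → p) (λ _ → _)
T-does (no ¬p) = mk⇔ (λ ()) ¬p

FeasibleFragment : ℚ → (ℕ → Bool) → ℕ → ℕ → Set
FeasibleFragment ms C a b = toℚ (b ∸ a) ≤ℚ ms × charged C a b ≤ 1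

validPred⇔ : ∀ ms C l i → T (validPred ms C l i) ⇔ (0 < l × l < i × FeasibleFragment ms C l i)
validPred⇔ ms C l i = mk⇔ sound complete
  where
  l≤?i-ms : Dec (toℚ i - ms ≤ℚ toℚ l)
  l≤?i-ms = toℚ i - ms ℚP.≤? toℚ l
  size⇔ : l ≤ i → (toℚ i - ms ≤ℚ toℚ l) ⇔ (toℚ (i ∸ l) ≤ℚ ms)
  size⇔ l≤i = subst (λ q → (q - ms ≤ℚ toℚ l) ⇔ (toℚ (i ∸ l) ≤ℚ ms))
                    (trans (sym (toℚ-+ (i ∸ l) l)) (cong toℚ (ℕP.m∸n+n≡m l≤i)))
                    (x+y-z≤y⇔x≤z (toℚ (i ∸ l)) (toℚ l) ms)
  sound : T (validPred ms C l i) → 0 < l × l < i × FeasibleFragment ms C l i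
  sound vp =
    let t₁ , vp₁ = to T-∧ vp ; t₂ , vp₂ = to T-∧ vp₁ ; t₃ , t₄ = to T-∧ vp₂
        l<i = ℕP.<ᵇ⇒< l i t₂
    in ℕP.≤ᵇ⇒≤ 1 l t₁ , l<i ,
       to (size⇔ (ℕP.<⇒≤ l<i)) (to (T-does l≤?i-ms) t₃) , ℕP.≤ᵇ⇒≤ _ 1 t₄
  complete : 0 < l × l < i × FeasibleFragment ms C l i → T (validPred ms C l i)
  complete (0<l , l<i , size , chg) =
    from T-∧ (ℕP.≤⇒≤ᵇ 0<l , from T-∧ (ℕP.<⇒<ᵇ l<i , from T-∧
      (from (T-does l≤?i-ms) (from (size⇔ (ℕP.<⇒≤ l<i)) size) , ℕP.≤⇒≤ᵇ chg)))

firstFragment⇔ : ∀ ms C i →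
  T ((1 ≤ᵇ i) ∧ does (toℚ i ℚP.≤? ms) ∧ (charged C 0 i ≤ᵇ 1)) ⇔
  (0 < i × FeasibleFragment ms C 0 i)
firstFragment⇔ ms C i = mk⇔
  (λ c → let t₁ , c₁ = to T-∧ c ; t₂ , t₃ = to T-∧ c₁
         in ℕP.≤ᵇ⇒≤ 1 i t₁ , to (T-does (toℚ i ℚP.≤? ms)) t₂ , ℕP.≤ᵇ⇒≤ _ 1 t₃)
  (λ (0<i , size , chg) →
     from T-∧ (ℕP.≤⇒≤ᵇ 0<i , from T-∧ (from (T-does (toℚ i ℚP.≤? ms)) size , ℕP.≤⇒≤ᵇ chg)))

AtMost : Ext → ℚ → Set
AtMost e y = ∃ λ x → e ≡ just x × x ≤ℚ y

minExt-just : ∀ a b → minExt (just a) (just b) ≡ just (a ⊓ b)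
minExt-just a@record{} b@record{} with a ℚ.≤ᵇ b
... | true  = refl
... | false = refl

minExt-AtMostˡ : ∀ {e₁ y} e₂ → AtMost e₁ y → AtMost (minExt e₁ e₂) y
minExt-AtMostˡ nothing  (a , refl , a≤y) = a , refl , a≤y
minExt-AtMostˡ (just b) (a , refl , a≤y) = a ⊓ b , minExt-just a b , ℚP.p≤q⇒p⊓r≤q b a≤y

minExt-AtMostʳ : ∀ e₁ {e₂ y} → AtMost e₂ y → AtMost (minExt e₁ e₂) y
minExt-AtMostʳ nothing  b≤y              = b≤y
minExt-AtMostʳ (just a) (b , refl , b≤y) = a ⊓ b , minExt-just a b , ℚP.p≤q⇒r⊓p≤q a b≤y

minExt-sel : ∀ e₁ e₂ {x} → minExt e₁ e₂ ≡ just x → e₁ ≡ just x ⊎ e₂ ≡ just x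
minExt-sel nothing  e₂       eq = inj₂ eq
minExt-sel (just a) nothing  eq = inj₁ eq
minExt-sel (just a) (just b) eq with ℚP.⊓-sel a b
... | inj₁ a⊓b≡a = inj₁ (trans (cong just (sym a⊓b≡a)) (trans (sym (minExt-just a b)) eq))
... | inj₂ a⊓b≡b = inj₂ (trans (cong just (sym a⊓b≡b)) (trans (sym (minExt-just a b)) eq))

addExt-AtMost : ∀ {e y} c → AtMost e y → AtMost (addExt e c) (y + c)
addExt-AtMost c (x , refl , x≤y) = x + c , refl , ℚP.+-monoˡ-≤ c x≤y

addExt-just : ∀ e c {x} → addExt e c ≡ just x → ∃ λ y → e ≡ just y × x ≡ y + c
addExt-just (just y) c refl = y , refl , refl

-- The recursive case of partCut is, definitionally, a minOver over between 0 i.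
minOver : (ℕ → Bool) → (ℕ → Ext) → List ℕ → Ext
minOver valid f = foldr (λ l acc → if valid l then minExt (f l) acc else acc) nothing

minOver-AtMost : ∀ valid f {l y} xs → l ∈ xs → T (valid l) → AtMost (f l) y →
                 AtMost (minOver valid f xs) y
minOver-AtMost valid f (x ∷ xs) (here refl) vl fl≤y with valid x
... | true = minExt-AtMostˡ (minOver valid f xs) fl≤y
minOver-AtMost valid f (x ∷ xs) (there l∈) vl fl≤y with valid x
... | true  = minExt-AtMostʳ (f x) (minOver-AtMost valid f xs l∈ vl fl≤y)
... | false = minOver-AtMost valid f xs l∈ vl fl≤y

minOver-attained : ∀ valid f xs {x} → minOver valid f xs ≡ just x →
                   ∃ λ l → T (valid l) × f l ≡ just x
minOver-attained valid f (l ∷ xs) eq with valid l in valid-l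
... | false = minOver-attained valid f xs eq
... | true with minExt-sel (f l) (minOver valid f xs) eq
...   | inj₁ fl≡x = l , from T-≡ valid-l , fl≡x
...   | inj₂ rest = minOver-attained valid f xs rest

≤-last : ∀ {m} (D : Fin (suc m) → ℕ) → (∀ t → D (inject₁ t) < D (fsuc t)) →
         ∀ t → D t ≤ D (fromℕ m)
≤-last {zero}  D incr fzero    = ℕP.≤-refl
≤-last {suc m} D incr fzero    =
  ℕP.<⇒≤ (ℕP.<-≤-trans (incr fzero) (≤-last (D ∘ fsuc) (incr ∘ fsuc) fzero))
≤-last {suc m} D incr (fsuc t) = ≤-last (D ∘ fsuc) (incr ∘ fsuc) t

d≤length : ∀ {i j} (p : ContPartition i j) t → d p t ≤ i
d≤length p t = subst (d p t ≤_) (d-last p) (≤-last (d p) (d-incr p) t)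

ContPartition-suc⇒0< : ∀ {i j} → ContPartition i (suc j) → 0 < i
ContPartition-suc⇒0< p =
  subst (_< _) (d-first p) (ℕP.<-≤-trans (d-incr p fzero) (d≤length p (fsuc fzero)))

noFragments : ContPartition 0 0
noFragments = record { d = λ _ → 0 ; d-first = refl ; d-last = refl ; d-incr = λ () }

dropLast : ∀ {i j} (p : ContPartition i (suc j)) → ContPartition (d p (inject₁ (fromℕ j))) j
dropLast p = record
  { d = init (d p) ; d-first = d-first p ; d-last = refl ; d-incr = d-incr p ∘ inject₁ }

dropLast< : ∀ {i j} (p : ContPartition i (suc j)) → d p (inject₁ (fromℕ j)) < i
dropLast< {j = j} p = subst (_ <_) (d-last p) (d-incr p (fromℕ j))

punchIn-fromℕ : ∀ {n} (t : Fin n) → punchIn (fromℕ n) t ≡ inject₁ t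
punchIn-fromℕ fzero    = refl
punchIn-fromℕ (fsuc t) = cong fsuc (punchIn-fromℕ t)

insertAt-fromℕ-inject₁ : ∀ {n} (D : Fin n → ℕ) x t → insertAt D (fromℕ n) x (inject₁ t) ≡ D t
insertAt-fromℕ-inject₁ {n} D x t =
  trans (cong (insertAt D (fromℕ n) x) (sym (punchIn-fromℕ t))) (insertAt-punchIn D (fromℕ n) x t)

addLast : ∀ {l i j} (q : ContPartition l j) → l < i → ContPartition i (suc j)
addLast {l} {i} {j} q l<i = record
  { d       = D
  ; d-first = d-first q
  ; d-last  = insertAt-lookup (d q) (fromℕ (suc j)) i
  ; d-incr  = incr
  }
  where
  D : Fin (suc (suc j)) → ℕ
  D = insertAt (d q) (fromℕ (suc j)) i
  incr : ∀ t → D (inject₁ t) < D (fsuc t)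
  incr t with view t
  ... | ‵fromℕ = subst₂ _<_ (sym (trans (insertAt-fromℕ-inject₁ (d q) i (fromℕ j)) (d-last q)))
                            (sym (insertAt-lookup (d q) (fromℕ (suc j)) i)) l<i
  ... | ‵inj₁ {i = t′} _ = subst₂ _<_ (sym (insertAt-fromℕ-inject₁ (d q) i (inject₁ t′)))
                                    (sym (insertAt-fromℕ-inject₁ (d q) i (fsuc t′))) (d-incr q t′)

Separates : ∀ {i j} → ContPartition i j → ℕ → ℕ → Set
Separates {j = j} p u v = ∃ λ (t : Fin (suc j)) → u ≤ d p t × d p t < v

separated⇔ : ∀ {i j} (p : ContPartition i j) u v → T (separated p u v) ⇔ Separates p u v
separated⇔ {j = j} p u v = mk⇔ sound complete
  where
  splits : Fin (suc j) → Bool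
  splits t = (u ≤ᵇ d p t) ∧ (d p t <ᵇ v)
  sound : T (separated p u v) → Separates p u v
  sound s = let t , st = satisfied (any⁻ splits (allFin (suc j)) s) ; u≤ , <v = to T-∧ st
            in t , ℕP.≤ᵇ⇒≤ u _ u≤ , ℕP.<ᵇ⇒< _ v <v
  complete : Separates p u v → T (separated p u v)
  complete (t , u≤ , <v) =
    any⁺ splits (lose (∈-allFin t) (from T-∧ (ℕP.≤⇒≤ᵇ u≤ , ℕP.<⇒<ᵇ <v)))

T⇔⇒≡ : ∀ {a b} → (T a → T b) → (T b → T a) → a ≡ b
T⇔⇒≡ {false} {false} _ _ = refl
T⇔⇒≡ {false} {true}  _ g = ⊥-elim (g _)
T⇔⇒≡ {true}  {false} f _ = ⊥-elim (f _)
T⇔⇒≡ {true}  {true}  _ _ = refl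

-- p is q followed by the single fragment {l+1, …, i}.
module LastFragment {i l j} (p : ContPartition i (suc j)) (q : ContPartition l j)
                    (init≡ : ∀ t → d p (inject₁ t) ≡ d q t) (l<i : l < i) where

  last≡ : d p (inject₁ (fromℕ j)) ≡ l
  last≡ = trans (init≡ (fromℕ j)) (d-last q)

  feasible⇔ : ∀ {ms C} → Feasible ms C p ⇔ (Feasible ms C q × FeasibleFragment ms C l i)
  feasible⇔ {ms} {C} = mk⇔ split join
    where
    split : Feasible ms C p → Feasible ms C q × FeasibleFragment ms C l i
    split fp =
      (λ t → subst₂ (FeasibleFragment ms C) (init≡ (inject₁ t)) (init≡ (fsuc t)) (fp (inject₁ t))) ,
      subst₂ (FeasibleFragment ms C) last≡ (d-last p) (fp (fromℕ j))
    join : Feasible ms C q × FeasibleFragment ms C l i → Feasible ms C p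
    join (fq , fl) t with view t
    ... | ‵fromℕ = subst₂ (FeasibleFragment ms C) (sym last≡) (sym (d-last p)) fl
    ... | ‵inj₁ {i = t′} _ =
      subst₂ (FeasibleFragment ms C) (sym (init≡ (inject₁ t′))) (sym (init≡ (fsuc t′))) (fq t′)

  separated-init : ∀ {u v} → v ≤ l → separated p u v ≡ separated q u v
  separated-init {u} {v} v≤l =
    T⇔⇒≡ (from (separated⇔ q u v) ∘ sound ∘ to (separated⇔ p u v))
         (from (separated⇔ p u v) ∘ complete ∘ to (separated⇔ q u v))
    where
    sound : Separates p u v → Separates q u v
    sound (t , u≤ , <v) with view t
    ... | ‵fromℕ = ⊥-elim (ℕP.<-asym (ℕP.≤-<-trans v≤l l<i) (subst (_< v) (d-last p) <v))
    ... | ‵inj₁ {i = t′} _ = t′ , subst (u ≤_) (init≡ t′) u≤ , subst (_< v) (init≡ t′) <v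
    complete : Separates q u v → Separates p u v
    complete (t , u≤ , <v) =
      inject₁ t , subst (u ≤_) (sym (init≡ t)) u≤ , subst (_< v) (sym (init≡ t)) <v

  separated-across : ∀ {u v} → u ≤ l → l < v → separated p u v ≡ true
  separated-across {u} {v} u≤l l<v =
    to T-≡ (from (separated⇔ p u v)
      (inject₁ (fromℕ j) , subst (u ≤_) (sym last≡) u≤l , subst (_< v) (sym last≡) l<v))

  separated-last : ∀ {u v} → l < u → v ≤ i → separated p u v ≡ false
  separated-last {u} {v} l<u v≤i = T⇔⇒≡ (impossible ∘ to (separated⇔ p u v)) λ ()
    where
    impossible : Separates p u v → T false
    impossible (t , u≤ , <v) with view t
    ... | ‵fromℕ = ⊥-elim (ℕP.<-irrefl refl (ℕP.<-≤-trans (subst (_< v) (d-last p) <v) v≤i))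
    ... | ‵inj₁ {i = t′} _ = ⊥-elim (ℕP.<-irrefl refl
      (ℕP.<-≤-trans l<u (ℕP.≤-trans u≤ (subst (_≤ l) (sym (init≡ t′)) (d≤length q t′)))))

  cutWeight≡ : ∀ E w → cutWeight E w p ≡ cutWeight E w q + cTab E w l i
  cutWeight≡ E w = begin
    sumℚ (map (row p i) (between 0 i))
      ≡⟨ sumℚ-between-++ (row p i) z≤n (ℕP.<⇒≤ l<i) ⟩
    sumℚ (map (row p i) (between 0 l)) + sumℚ (map (row p i) (between l i))
      ≡⟨ cong₂ _+_ rows-init rows-last ⟩
    (cutWeight E w q + cTab E w l i) + 0ℚ
      ≡⟨ ℚP.+-identityʳ _ ⟩
    cutWeight E w q + cTab E w l i
      ∎
    where
    open ≡-Reasoning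
    cutEdge : ∀ {i′ j′} → ContPartition i′ j′ → ℕ → ℕ → ℚ
    cutEdge r u v = if E u v ∧ separated r u v then w u v else 0ℚ
    edge : ℕ → ℕ → ℚ
    edge u v = if E u v then w u v else 0ℚ
    row : ∀ {i′ j′} → ContPartition i′ j′ → ℕ → ℕ → ℚ
    row r b u = sumℚ (map (cutEdge r u) (between u b))

    row-init : ∀ {u} → u ∈ between 0 l → row p i u ≡ row q l u + sumℚ (map (edge u) (between l i))
    row-init {u} u∈ =
      trans (sumℚ-between-++ (cutEdge p u) u≤l (ℕP.<⇒≤ l<i))
            (cong₂ _+_ (sumℚ-map-cong (between u l) inside) (sumℚ-map-cong (between l i) across))
      where
      u≤l : u ≤ l
      u≤l = proj₂ (∈-between⁻ {0} u∈)
      inside : ∀ {v} → v ∈ between u l → cutEdge p u v ≡ cutEdge q u v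
      inside {v} v∈ =
        cong (λ s → if E u v ∧ s then w u v else 0ℚ) (separated-init {u} (proj₂ (∈-between⁻ {u} v∈)))
      across : ∀ {v} → v ∈ between l i → cutEdge p u v ≡ edge u v
      across {v} v∈ = cong (λ s → if s then w u v else 0ℚ)
        (trans (cong (E u v ∧_) (separated-across {u} {v} u≤l (proj₁ (∈-between⁻ {l} v∈))))
               (∧-identityʳ (E u v)))

    rows-init : sumℚ (map (row p i) (between 0 l)) ≡ cutWeight E w q + cTab E w l i
    rows-init = trans (sumℚ-map-cong (between 0 l) row-init)
                      (sumℚ-map-+ (row q l) (λ u → sumℚ (map (edge u) (between l i))) (between 0 l))

    rows-last : sumℚ (map (row p i) (between l i)) ≡ 0ℚ
    rows-last =
      sumℚ-map-vanishing (between l i) λ {u} u∈ → sumℚ-map-vanishing (between u i) λ {v} v∈ →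
        cong (λ s → if s then w u v else 0ℚ)
          (trans (cong (E u v ∧_)
                   (separated-last {u} {v} (proj₁ (∈-between⁻ {l} u∈)) (proj₂ (∈-between⁻ {u} v∈))))
                 (∧-zeroʳ (E u v)))

IsMinCut-intro : ∀ {ms C E w i j} r →
  (∀ {x} → r ≡ just x → ∃ λ (p : ContPartition i j) → Feasible ms C p × cutWeight E w p ≡ x) →
  ((p : ContPartition i j) → Feasible ms C p → AtMost r (cutWeight E w p)) →
  IsMinCut ms C E w i j r
IsMinCut-intro {ms} {C} {E} {w} {i} {j} (just x) attained bounded = attained refl , least
  where
  least : (p : ContPartition i j) → Feasible ms C p → x ≤ℚ cutWeight E w p
  least p fp with _ , refl , x≤ ← bounded p fp = x≤
IsMinCut-intro nothing attained bounded (p , fp) with bounded p fp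
... | _ , () , _

IsMinCut⇒AtMost : ∀ {ms C E w i j} r → IsMinCut ms C E w i j r →
                  (p : ContPartition i j) → Feasible ms C p → AtMost r (cutWeight E w p)
IsMinCut⇒AtMost (just x) (_ , least) p fp = x , refl , least p fp
IsMinCut⇒AtMost nothing  none        p fp = ⊥-elim (none (p , fp))

startsAtZero : ∀ {i} (p : ContPartition i 1) t → d p (inject₁ t) ≡ d noFragments t
startsAtZero p fzero = d-first p

module OneFragment {i} (p : ContPartition i 1) =
  LastFragment p noFragments (startsAtZero p) (ContPartition-suc⇒0< p)

oneFragment-IsMinCut : ∀ {ms C E w i} b → (T b ⇔ (0 < i × FeasibleFragment ms C 0 i)) →
                       IsMinCut ms C E w i 1 (if b then just 0ℚ else nothing)
oneFragment-IsMinCut {ms} {C} {E} {w} {i} true spec =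
  (single , from feasible⇔ ((λ ()) , ff) , cutWeight≡0 single) ,
  λ p _ → ℚP.≤-reflexive (sym (cutWeight≡0 p))
  where
  0<i : 0 < i
  0<i = proj₁ (to spec _)
  ff : FeasibleFragment ms C 0 i
  ff = proj₂ (to spec _)
  single : ContPartition i 1
  single = addLast noFragments 0<i
  open OneFragment single using (feasible⇔)
  cutWeight≡0 : (p : ContPartition i 1) → cutWeight E w p ≡ 0ℚ
  cutWeight≡0 p = trans (OneFragment.cutWeight≡ p E w) (ℚP.+-identityʳ 0ℚ)
oneFragment-IsMinCut false spec (p , fp) =
  from spec (ContPartition-suc⇒0< p , proj₂ (to (OneFragment.feasible⇔ p) fp))

module Correctness (n k : ℕ) (ε : ℚ) (E : ℕ → ℕ → Bool) (w : ℕ → ℕ → ℚ) (C : ℕ → Bool) where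

  ms : ℚ
  ms = maxSize n k ε

  table : ℕ → ℕ → Ext
  table = partCut n k ε E w C

  Correct : ℕ → ℕ → Set
  Correct i j = IsMinCut ms C E w i j (table i j)

  table-one : ∀ i → Correct i 1
  table-one i = oneFragment-IsMinCut _ (firstFragment⇔ ms C i)

  module Step {j} (correct : ∀ l → Correct l (suc j)) (i : ℕ) where

    valid : ℕ → Bool
    valid l = validPred ms C l i

    candidate : ℕ → Ext
    candidate l = addExt (table l (suc j)) (cTab E w l i)

    appendFragment : ∀ {l y} (q : ContPartition l (suc j)) → Feasible ms C q → cutWeight E w q ≡ y →
                     l < i → FeasibleFragment ms C l i →
                     ∃ λ (p : ContPartition i (suc (suc j))) →
                       Feasible ms C p × cutWeight E w p ≡ y + cTab E w l i
    appendFragment {l} q fq cut≡ l<i fl =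
      addLast q l<i , from feasible⇔ (fq , fl) , trans (cutWeight≡ E w) (cong (_+ cTab E w l i) cut≡)
      where open LastFragment (addLast q l<i) q (insertAt-fromℕ-inject₁ (d q) i) l<i

    extendOptimal : ∀ {l x y} → T (valid l) → table l (suc j) ≡ just y → x ≡ y + cTab E w l i →
                    ∃ λ (p : ContPartition i (suc (suc j))) → Feasible ms C p × cutWeight E w p ≡ x
    extendOptimal {l} vl table≡ x≡ =
      let (q , fq , cut≡) , _ = subst (IsMinCut ms C E w l (suc j)) table≡ (correct l)
          _ , l<i , fl = to (validPred⇔ ms C l i) vl
          p , fp , cut-p≡ = appendFragment q fq cut≡ l<i fl
      in p , fp , trans cut-p≡ (sym x≡)

    attained : ∀ {x} → table i (suc (suc j)) ≡ just x →
               ∃ λ (p : ContPartition i (suc (suc j))) → Feasible ms C p × cutWeight E w p ≡ x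
    attained eq =
      let l , vl , candidate≡ = minOver-attained valid candidate (between 0 i) eq
          y , table≡ , x≡ = addExt-just (table l (suc j)) (cTab E w l i) candidate≡
      in extendOptimal vl table≡ x≡

    bounded : (p : ContPartition i (suc (suc j))) → Feasible ms C p →
              AtMost (table i (suc (suc j))) (cutWeight E w p)
    bounded p fp = subst (AtMost (table i (suc (suc j)))) (sym (cutWeight≡ E w)) optimum≤
      where
      l : ℕ
      l = d p (inject₁ (fromℕ (suc j)))
      open LastFragment p (dropLast p) (λ _ → refl) (dropLast< p)
      fq : Feasible ms C (dropLast p)
      fq = proj₁ (to feasible⇔ fp)
      fl : FeasibleFragment ms C l i
      fl = proj₂ (to feasible⇔ fp)
      0<l : 0 < l
      0<l = ContPartition-suc⇒0< (dropLast p)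
      candidate≤ : AtMost (candidate l) (cutWeight E w (dropLast p) + cTab E w l i)
      candidate≤ = addExt-AtMost (cTab E w l i)
                     (IsMinCut⇒AtMost (table l (suc j)) (correct l) (dropLast p) fq)
      optimum≤ : AtMost (table i (suc (suc j))) (cutWeight E w (dropLast p) + cTab E w l i)
      optimum≤ = minOver-AtMost valid candidate (between 0 i) (∈-between⁺ 0<l (ℕP.<⇒≤ (dropLast< p)))
                   (from (validPred⇔ ms C l i) (0<l , dropLast< p , fl)) candidate≤

  table-suc : ∀ {j} → (∀ l → Correct l (suc j)) → ∀ i → Correct i (suc (suc j))
  table-suc {j} correct i = IsMinCut-intro (table i (suc (suc j))) attained bounded
    where open Step correct i

  table-correct : ∀ j i → Correct i (suc j)
  table-correct zero    = table-one
  table-correct (suc j) = table-suc (table-correct j)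

lemma1 : (n k : ℕ) → 2 ≤ k → (ε : ℚ) → 0ℚ ≤ℚ ε
    → (E : ℕ → ℕ → Bool) → (∀ u v → E u v ≡ E v u)
    → (w : ℕ → ℕ → ℚ) → (∀ u v → 0ℚ ≤ℚ w u v) → (∀ u v → w u v ≡ w v u)
    → (C : ℕ → Bool)
    → (i j : ℕ) → 1 ≤ i → i ≤ n → 1 ≤ j → j ≤ k
    → IsMinCut (maxSize n k ε) C E w i j (partCut n k ε E w C i j)
lemma1 n k _ ε _ E _ w _ _ C i (suc j) _ _ _ _ = Correctness.table-correct n k ε E w C j i
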